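{- For every positive integer $n$, the unique shape of $(p,n)$-prismatic polyominoes, where $p$ is the square tetromino, is the $(n^2+1)\times(n^2+1)$ square.
   Context: Cells are the unit squares of the square lattice, indexed by integer coordinates $(x,y)$. A polyomino is a finite nonempty edge-connected set of cells; its size is its number of cells; polyominoes are considered up to translation. The square tetromino is the $2\times2$ block $\{(0,0),(1,0),(0,1),(1,1)\}$. An $n$-coloring of a set of cells assigns each cell a color in $\{1,\dots,n\}$. An instance of a shape $p$ is a translate of $p$; an instance contained in a colored set is colored by restriction, and two instances have the same coloring if the colorings agree under the translation between them. A de Bruijn polyomino for $(p,n)$ is an $n$-colored polyomino containing exactly one instance of each of the $n^{|p|}$ distinct $n$-colorings of $p$; a $(p,n)$-prismatic polyomino is a de Bruijn polyomino for $(p,n)$ of minimum size. -}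

module Defs where

open import Data.Nat using (ℕ; _≤_; _^_; _+_)
open import Data.Integer as ℤ using (ℤ; +_)
open import Data.Fin using (Fin)
open import Data.Product using (_×_; _,_; Σ; ∃-syntax)
open import Data.List using (List; []; _∷_; length)
open import Data.List.Membership.Propositional using (_∈_)
open import Data.List.Relation.Unary.Unique.Propositional using (Unique)
open import Relation.Binary.PropositionalEquality using (_≡_; _≢_)
open import Function.Bundles using (_⇔_)

Cell : Set
Cell = ℤ × ℤ

_⊕_ : Cell → Cell → Cell
(a , b) ⊕ (c , d) = (a ℤ.+ c , b ℤ.+ d)

Adjacent : Cell → Cell → Set
Adjacent (a , b) (c , d) = ℤ.∣ a ℤ.- c ∣ + ℤ.∣ b ℤ.- d ∣ ≡ 1

data PathIn (S : List Cell) : Cell → Cell → Set where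
  here : ∀ {u} → u ∈ S → PathIn S u u
  step : ∀ {u w v} → u ∈ S → Adjacent u w → PathIn S w v → PathIn S u v

EdgeConnected : List Cell → Set
EdgeConnected S = ∀ {u v} → u ∈ S → v ∈ S → PathIn S u v

record Polyomino : Set where
  field
    cells     : List Cell
    unique    : Unique cells
    nonempty  : cells ≢ []
    connected : EdgeConnected cells

open Polyomino public

size : Polyomino → ℕ
size P = length (cells P)

-- An n-coloring of the cells (only values on cells of the polyomino matter).
Coloring : ℕ → Set
Coloring n = Cell → Fin n

-- The square tetromino {(0,0),(1,0),(0,1),(1,1)}.
-- An instance of it is its translate by v; it is contained in P when all
-- four cells lie in P.
InstanceIn : Polyomino → Cell → Set
InstanceIn P v =
  (v ⊕ (+ 0 , + 0)) ∈ cells P × (v ⊕ (+ 1 , + 0)) ∈ cells P ×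
  (v ⊕ (+ 0 , + 1)) ∈ cells P × (v ⊕ (+ 1 , + 1)) ∈ cells P

-- An n-coloring of the square tetromino: colors of (0,0),(1,0),(0,1),(1,1).
TetColoring : ℕ → Set
TetColoring n = Fin n × Fin n × Fin n × Fin n

instColoring : ∀ {n} → Coloring n → Cell → TetColoring n
instColoring c v =
  c (v ⊕ (+ 0 , + 0)) , c (v ⊕ (+ 1 , + 0)) ,
  c (v ⊕ (+ 0 , + 1)) , c (v ⊕ (+ 1 , + 1))

IsDeBruijn : (n : ℕ) → Polyomino → Coloring n → Set
IsDeBruijn n P c =
  (π : TetColoring n) →
  ∃[ v ] ((InstanceIn P v × instColoring c v ≡ π) ×
          (∀ w → InstanceIn P w → instColoring c w ≡ π → w ≡ v))

IsPrismatic : (n : ℕ) → Polyomino → Coloring n → Set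
IsPrismatic n P c =
  IsDeBruijn n P c × (∀ (Q : Polyomino) (d : Coloring n) → IsDeBruijn n Q d → size P ≤ size Q)

InSquare : ℕ → Cell → Set
InSquare k (x , y) =
  (+ 0 ℤ.≤ x) × (x ℤ.< + k) × (+ 0 ℤ.≤ y) × (y ℤ.< + k)

HasSquareShape : ℕ → Polyomino → Set
HasSquareShape k P = ∃[ t ] (∀ (u : Cell) → (u ⊕ t) ∈ cells P ⇔ InSquare k u)

{-# OPTIONS --safe #-}
module Submission where

-- Let N = n². The lower-left corners of the N² instances in a de Bruijn polyomino form a set T
-- of N² cells spanning r rows and c columns. Shifting T one step right adds a new cell at the end
-- of each row; shifting the union one step up adds a new cell at the end of each of its columns,
-- of which there is one more than in T. So the polyomino has at least N² + r + c + 1 cells, and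
-- rc ≥ N² gives r + c ≥ 2N by AM-GM. The (N + 1) × (N + 1) square attains this bound: its row y
-- is a cyclic sequence of length N containing each ordered pair of colors once as consecutive
-- letters, shifted by y(y - 1)/2. The lower pair of colors of the instance at (i , j) determines
-- i + j(j - 1)/2 mod N, the upper pair determines that plus j, and together they determine
-- (i , j). In a polyomino with (N + 1)² cells every inequality is tight: r = c = N, T is the
-- product of its columns and its rows, and both are intervals, so the polyomino is a square.

open import Data.Nat using (ℕ; zero; suc; _+_; _*_; _^_; _≤_; _<_; z≤n; s≤s; s≤s⁻¹; NonZero; ∣_-_∣)
import Data.Nat.Properties as ℕ
open import Data.Nat.DivMod using (_%_; %-distribˡ-+; m%n%n≡m%n; [m+kn]%n≡m%n; m%n<n; m<n⇒m%n≡m; n%n≡0)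
open import Data.Nat.Tactic.RingSolver using (solve-∀)
open import Data.Integer as ℤ using (ℤ; +_; 1ℤ; +≤+; +<+)
import Data.Integer.Properties as ℤ
import Data.Integer.Tactic.RingSolver as ℤSolver
open import Algebra.Properties.AbelianGroup ℤ.+-0-abelianGroup using (∙-cancelʳ)
open import Data.Fin using (Fin; toℕ; fromℕ<)
import Data.Fin.Properties as Fin
open import Data.List using (List; []; _∷_; length; map; filter; _++_; upTo; allFin; cartesianProduct; deduplicate)
open import Data.List.Properties using (filter-notAll; length-++; length-map; length-upTo; length-tabulate)
import Data.List.Extrema ℤ.≤-totalOrder as ℤExtrema
open ℤExtrema using (max; min; argmax; argmax-sel; argmin-sel; argmax-all; xs≤max; min≤xs; f[xs]≤f[argmax])
open import Data.List.Membership.Propositional using (_∈_; _∉_)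
open import Data.List.Membership.Propositional.Properties
  using (∈-map⁺; ∈-map⁻; ∈-filter⁺; ∈-filter⁻; ∈-++⁺ˡ; ∈-++⁺ʳ; ∈-++⁻; ∈-upTo⁺; ∈-upTo⁻; ∈-allFin;
         ∈-cartesianProduct⁺; ∈-cartesianProduct⁻; ∈-deduplicate⁺; ∈-deduplicate⁻)
open import Data.List.Relation.Binary.Subset.Propositional using (_⊆_)
open import Data.List.Relation.Binary.Disjoint.Propositional using (Disjoint)
open import Data.List.Relation.Unary.Any using (here; there)
import Data.List.Relation.Unary.Any as Any
import Data.List.Relation.Unary.All as All
open import Data.List.Relation.Unary.All.Properties using (¬Any⇒All¬)
open import Data.List.Relation.Unary.AllPairs using (_∷_)
open import Data.List.Relation.Unary.Unique.Propositional using (Unique)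
open import Data.List.Relation.Unary.Unique.Propositional.Properties using (++⁺; map⁺; upTo⁺; allFin⁺; cartesianProduct⁺)
open import Data.List.Relation.Unary.Unique.DecPropositional.Properties using (deduplicate-!)
open import Data.Product using (_×_; _,_; proj₁; proj₂; ∃; ∃-syntax)
import Data.Product as Product
open import Data.Product.Properties using (≡-dec)
open import Data.Sum using (_⊎_; inj₁; inj₂; [_,_]′)
open import Data.Empty using (⊥-elim)
open import Function using (id; _∘_)
open import Function.Bundles using (_⇔_; mk⇔)
open import Relation.Binary.Definitions using (DecidableEquality; tri<; tri≈; tri>)
open import Relation.Binary.PropositionalEquality
open import Relation.Nullary using (yes; no; ¬?)

open import Defs

Unique-∷ : {A : Set} {x : A} {xs : List A} → x ∉ xs → Unique xs → Unique (x ∷ xs)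
Unique-∷ {xs = xs} x∉xs u = ¬Any⇒All¬ xs x∉xs ∷ u

length-cartesianProduct : {A B : Set} (xs : List A) (ys : List B) →
                          length (cartesianProduct xs ys) ≡ length xs * length ys
length-cartesianProduct []       ys = refl
length-cartesianProduct (x ∷ xs) ys =
  trans (length-++ (map (x ,_) ys)) (cong₂ _+_ (length-map _ ys) (length-cartesianProduct xs ys))

module _ {A : Set} (_≟_ : DecidableEquality A) where

  open import Data.List.Membership.DecPropositional _≟_ using (_∈?_)

  Unique-⊆⇒length≤ : ∀ {xs ys : List A} → Unique xs → xs ⊆ ys → length xs ≤ length ys
  Unique-⊆⇒length≤ {[]}          _            _       = z≤n
  Unique-⊆⇒length≤ {x ∷ xs} {ys} (x∉xs ∷ u) x∷xs⊆ys =
    ℕ.≤-trans (s≤s (Unique-⊆⇒length≤ u xs⊆ys∖x)) ys∖x<ys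
    where
    ≢x? = λ y → ¬? (x ≟ y)
    ys∖x<ys = filter-notAll ≢x? ys (Any.map (λ x≡y x≢y → x≢y x≡y) (x∷xs⊆ys (here refl)))
    xs⊆ys∖x : xs ⊆ filter ≢x? ys
    xs⊆ys∖x y∈xs = ∈-filter⁺ ≢x? (x∷xs⊆ys (there y∈xs)) (All.lookup x∉xs y∈xs)

  fresh-⊆⇒length< : ∀ {x} {xs ys : List A} → Unique xs → x ∉ xs → x ∷ xs ⊆ ys → length xs < length ys
  fresh-⊆⇒length< u x∉xs = Unique-⊆⇒length≤ (Unique-∷ x∉xs u)

  Unique-⊆-length≥⇒⊇ : ∀ {xs ys : List A} → Unique xs → xs ⊆ ys → length ys ≤ length xs → ys ⊆ xs
  Unique-⊆-length≥⇒⊇ {xs} {ys} u xs⊆ys ys≤xs {y} y∈ys with y ∈? xs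
  ... | yes y∈xs = y∈xs
  ... | no  y∉xs = ⊥-elim (ℕ.<⇒≱ (fresh-⊆⇒length< u y∉xs y∷xs⊆ys) ys≤xs)
    where
    y∷xs⊆ys : y ∷ xs ⊆ ys
    y∷xs⊆ys (here refl)  = y∈ys
    y∷xs⊆ys (there z∈xs) = xs⊆ys z∈xs

square-suc : ∀ m → suc m * suc m ≡ suc (m * m + (m + m))
square-suc = solve-∀

square<square⇒< : ∀ {x n} → x * x < n * n → x < n
square<square⇒< lt = ℕ.≰⇒> (λ n≤x → ℕ.<⇒≱ lt (ℕ.*-mono-≤ n≤x n≤x))

sum-square : ∀ c r → (c + r) * (c + r) ≡ 4 * (c * r) + ∣ c - r ∣ * ∣ c - r ∣
sum-square c r with ℕ.≤-total c r
... | inj₁ c≤r with ℕ.m≤n⇒∃[o]m+o≡n c≤r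
...   | d , refl = trans (expand c d) (cong (λ e → 4 * (c * (c + d)) + e * e) (sym (ℕ.∣m-m+n∣≡n c d)))
  where
  expand : ∀ c d → (c + (c + d)) * (c + (c + d)) ≡ 4 * (c * (c + d)) + d * d
  expand = solve-∀
sum-square c r | inj₂ r≤c with ℕ.m≤n⇒∃[o]m+o≡n r≤c
...   | d , refl = trans (expand r d) (cong (λ e → 4 * ((r + d) * r) + e * e) (sym ∣r+d-r∣≡d))
  where
  expand : ∀ r d → (r + d + r) * (r + d + r) ≡ 4 * ((r + d) * r) + d * d
  expand = solve-∀
  ∣r+d-r∣≡d : ∣ r + d - r ∣ ≡ d
  ∣r+d-r∣≡d = trans (ℕ.∣-∣-comm (r + d) r) (ℕ.∣m-m+n∣≡n r d)

double-square : ∀ m → (m + m) * (m + m) ≡ 4 * (m * m)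
double-square = solve-∀

am-gm : ∀ m c r → m * m ≤ c * r → m + m ≤ c + r
am-gm m c r mm≤cr = ℕ.≮⇒≥ λ c+r<2m → ℕ.<⇒≱ (ℕ.*-mono-< c+r<2m c+r<2m) (begin
  (m + m) * (m + m)                   ≡⟨ double-square m ⟩
  4 * (m * m)                         ≤⟨ ℕ.*-monoʳ-≤ 4 mm≤cr ⟩
  4 * (c * r)                         ≤⟨ ℕ.m≤m+n _ _ ⟩
  4 * (c * r) + ∣ c - r ∣ * ∣ c - r ∣ ≡⟨ sum-square c r ⟨
  (c + r) * (c + r)                   ∎)
  where open ℕ.≤-Reasoning

am-gm-equality : ∀ m c r → c + r ≤ m + m → m * m ≤ c * r → c ≡ m × r ≡ m
am-gm-equality m c r c+r≤2m mm≤cr = c≡m , trans (sym c≡r) c≡m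
  where
  c+r≡2m : c + r ≡ m + m
  c+r≡2m = ℕ.≤-antisym c+r≤2m (am-gm m c r mm≤cr)
  d = ∣ c - r ∣
  d*d≤0 : 4 * (c * r) + d * d ≤ 4 * (c * r) + 0
  d*d≤0 = begin
    4 * (c * r) + d * d ≡⟨ sum-square c r ⟨
    (c + r) * (c + r)   ≡⟨ cong (λ s → s * s) c+r≡2m ⟩
    (m + m) * (m + m)   ≡⟨ double-square m ⟩
    4 * (m * m)         ≤⟨ ℕ.*-monoʳ-≤ 4 mm≤cr ⟩
    4 * (c * r)         ≡⟨ ℕ.+-identityʳ _ ⟨
    4 * (c * r) + 0     ∎
    where open ℕ.≤-Reasoning
  c≡r : c ≡ r
  c≡r = ℕ.∣m-n∣≡0⇒m≡n ([ id , id ]′ (ℕ.m*n≡0⇒m≡0∨n≡0 d (ℕ.n≤0⇒n≡0 (ℕ.+-cancelˡ-≤ _ _ _ d*d≤0))))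
  c≡m : c ≡ m
  c≡m = ℕ.*-cancelˡ-≡ c m 2 (trans (double c) (trans (cong (λ x → c + x) c≡r) (trans c+r≡2m (sym (double m)))))
    where
    double : ∀ x → 2 * x ≡ x + x
    double = solve-∀

[m+n%d]%d≡[m+n]%d : ∀ m n d .{{_ : NonZero d}} → (m + n % d) % d ≡ (m + n) % d
[m+n%d]%d≡[m+n]%d m n d = begin
  (m + n % d) % d         ≡⟨ %-distribˡ-+ m (n % d) d ⟩
  (m % d + n % d % d) % d ≡⟨ cong (λ x → (m % d + x) % d) (m%n%n≡m%n n d) ⟩
  (m % d + n % d) % d     ≡⟨ %-distribˡ-+ m n d ⟨
  (m + n) % d             ∎
  where open ≡-Reasoning

%-congˡ-+ : ∀ a a' b d .{{_ : NonZero d}} → a % d ≡ a' % d → (a + b) % d ≡ (a' + b) % d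
%-congˡ-+ a a' b d eq = begin
  (a + b) % d          ≡⟨ %-distribˡ-+ a b d ⟩
  (a % d + b % d) % d  ≡⟨ cong (λ x → (x + b % d) % d) eq ⟩
  (a' % d + b % d) % d ≡⟨ %-distribˡ-+ a' b d ⟨
  (a' + b) % d         ∎
  where open ≡-Reasoning

%-cancelˡ-+ : ∀ c b b' d .{{_ : NonZero d}} → (c + b) % d ≡ (c + b') % d → b % d ≡ b' % d
%-cancelˡ-+ c b b' d@(suc d-1) eq = trans (via b) (trans (cong (λ x → (c * d-1 + x) % d) eq) (sym (via b')))
  where
  -- adding c * d does not change the residue, and c * d = c * (d - 1) + c
  via : ∀ b → b % d ≡ (c * d-1 + (c + b) % d) % d
  via b = begin
    b % d                       ≡⟨ [m+kn]%n≡m%n b c d ⟨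
    (b + c * d) % d             ≡⟨ cong (_% d) (shuffle b c d-1) ⟩
    (c * d-1 + (c + b)) % d     ≡⟨ [m+n%d]%d≡[m+n]%d (c * d-1) (c + b) d ⟨
    (c * d-1 + (c + b) % d) % d ∎
    where
    open ≡-Reasoning
    shuffle : ∀ b c e → b + c * suc e ≡ c * e + (c + b)
    shuffle = solve-∀

%-cancelʳ-+ : ∀ c b b' d .{{_ : NonZero d}} → (b + c) % d ≡ (b' + c) % d → b % d ≡ b' % d
%-cancelʳ-+ c b b' d eq = %-cancelˡ-+ c b b' d (subst₂ (λ x y → x % d ≡ y % d) (ℕ.+-comm b c) (ℕ.+-comm b' c) eq)

-- A cyclic sequence containing every ordered pair of letters exactly once

-- For a ≥ 1 the walk runs through the pairs (x , y) with max x y = a in the order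
-- (0 , a) (a , 1) (1 , a) (a , 2) … (a - 1 , a) (a , a) (a , 0) and then moves on to (0 , a + 1);
-- consecutive pairs overlap in one letter. rank is the position of a pair on the walk, so these
-- pairs occupy the positions a², …, a² + 2a.
next : ℕ × ℕ → ℕ × ℕ
next (x , zero) = (zero , suc x)
next (x , suc j) with ℕ.<-cmp x (suc j)
... | tri< _ _ _ = (suc j , suc x)
... | tri≈ _ _ _ = (x , zero)
... | tri> _ _ _ = (suc j , x)

rank : ℕ × ℕ → ℕ
rank (x , zero) = x * x + (x + x)
rank (x , suc j) with ℕ.<-cmp x (suc j)
... | tri< _ _ _ = suc j * suc j + (x + x)
... | tri≈ _ _ _ = x * x + suc (j + j)
... | tri> _ _ _ = x * x + suc (j + j)

rank-< : ∀ {x y} → x < y → rank (x , y) ≡ y * y + (x + x)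
rank-< {x} {suc j} x<y with ℕ.<-cmp x (suc j)
... | tri< _   _ _ = refl
... | tri≈ x≮y _ _ = ⊥-elim (x≮y x<y)
... | tri> x≮y _ _ = ⊥-elim (x≮y x<y)

rank-≥ : ∀ {x j} → suc j ≤ x → rank (x , suc j) ≡ x * x + suc (j + j)
rank-≥ {x} {j} y≤x with ℕ.<-cmp x (suc j)
... | tri< x<y _ _ = ⊥-elim (ℕ.<⇒≱ x<y y≤x)
... | tri≈ _ _ _   = refl
... | tri> _ _ _   = refl

proj₁-next : ∀ u → proj₁ (next u) ≡ proj₂ u
proj₁-next (x , zero) = refl
proj₁-next (x , suc j) with ℕ.<-cmp x (suc j)
... | tri< _ _    _ = refl
... | tri≈ _ refl _ = refl
... | tri> _ _    _ = refl

rank-next : ∀ u → rank (next u) ≡ suc (rank u)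
rank-next (x , zero) = trans (rank-< {0} {suc x} (s≤s z≤n)) (trans (ℕ.+-identityʳ _) (square-suc x))
rank-next (x , suc j) with ℕ.<-cmp x (suc j)
... | tri< x<y _ _ = trans (rank-≥ x<y) (ℕ.+-suc _ (x + x))
... | tri≈ _ refl _ = diagonal j
  where
  diagonal : ∀ j → suc j * suc j + (suc j + suc j) ≡ suc (suc j * suc j + suc (j + j))
  diagonal = solve-∀
... | tri> _ _ y<x = trans (rank-< y<x) (below-diagonal x j)
  where
  below-diagonal : ∀ x j → x * x + (suc j + suc j) ≡ suc (x * x + suc (j + j))
  below-diagonal = solve-∀

square≤rank : ∀ x y → x * x ≤ rank (x , y) × y * y ≤ rank (x , y)
square≤rank x zero = ℕ.m≤m+n (x * x) (x + x) , z≤n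
square≤rank x (suc j) with ℕ.<-cmp x (suc j)
... | tri< x<y _ _ = ℕ.≤-trans (ℕ.*-mono-≤ (ℕ.<⇒≤ x<y) (ℕ.<⇒≤ x<y)) y*y≤ , y*y≤
  where y*y≤ = ℕ.m≤m+n (suc j * suc j) (x + x)
... | tri≈ _ refl _ = ℕ.m≤m+n (x * x) _ , ℕ.m≤m+n (x * x) _
... | tri> _ _ y<x = ℕ.m≤m+n (x * x) _ , ℕ.≤-trans (ℕ.*-mono-≤ (ℕ.<⇒≤ y<x) (ℕ.<⇒≤ y<x)) (ℕ.m≤m+n (x * x) _)

pairAt : ℕ → ℕ × ℕ
pairAt zero    = (0 , 0)
pairAt (suc p) = next (pairAt p)

rank-pairAt : ∀ p → rank (pairAt p) ≡ p
rank-pairAt zero    = refl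
rank-pairAt (suc p) = trans (rank-next (pairAt p)) (cong suc (rank-pairAt p))

pairAt-injective : ∀ {p q} → pairAt p ≡ pairAt q → p ≡ q
pairAt-injective {p} {q} eq = trans (sym (rank-pairAt p)) (trans (cong rank eq) (rank-pairAt q))

module PairCycle (k : ℕ) where

  n N : ℕ
  n = suc k
  N = n * n

  pairAt-< : ∀ {p} → p < N → proj₁ (pairAt p) < n × proj₂ (pairAt p) < n
  pairAt-< {p} p<N with pairAt p | rank-pairAt p
  ... | (x , y) | refl = let (x*x≤ , y*y≤) = square≤rank x y in
    square<square⇒< (ℕ.≤-<-trans x*x≤ p<N) , square<square⇒< (ℕ.≤-<-trans y*y≤ p<N)

  letterPairs walk : List (ℕ × ℕ)
  letterPairs = cartesianProduct (upTo n) (upTo n)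
  walk        = map pairAt (upTo N)

  walk⊆letterPairs : walk ⊆ letterPairs
  walk⊆letterPairs u∈walk with ∈-map⁻ pairAt u∈walk
  ... | p , p∈ , refl = let (x<n , y<n) = pairAt-< (∈-upTo⁻ p∈) in
    ∈-cartesianProduct⁺ (∈-upTo⁺ x<n) (∈-upTo⁺ y<n)

  letterPairs⊆walk : letterPairs ⊆ walk
  letterPairs⊆walk = Unique-⊆-length≥⇒⊇ (≡-dec ℕ._≟_ ℕ._≟_) (map⁺ pairAt-injective (upTo⁺ N)) walk⊆letterPairs
    (ℕ.≤-reflexive (begin
      length letterPairs                ≡⟨ length-cartesianProduct (upTo n) (upTo n) ⟩
      length (upTo n) * length (upTo n) ≡⟨ cong₂ _*_ (length-upTo n) (length-upTo n) ⟩
      N                                 ≡⟨ length-upTo N ⟨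
      length (upTo N)                   ≡⟨ length-map pairAt (upTo N) ⟨
      length walk                       ∎))
    where open ≡-Reasoning

  pairAt-onto : ∀ {x y} → x < n → y < n → ∃ λ p → pairAt p ≡ (x , y)
  pairAt-onto x<n y<n with ∈-map⁻ pairAt {xs = upTo N} (letterPairs⊆walk (∈-cartesianProduct⁺ (∈-upTo⁺ x<n) (∈-upTo⁺ y<n)))
  ... | p , _ , eq = p , sym eq

  pairAt-last : pairAt (k * k + (k + k)) ≡ (k , 0)
  pairAt-last with pairAt-onto {k} {0} (ℕ.n<1+n k) (s≤s z≤n)
  ... | p , eq = subst (λ q → pairAt q ≡ (k , 0)) (trans (sym (rank-pairAt p)) (cong rank eq)) eq

  letter : ℕ → ℕ
  letter p = proj₁ (pairAt (p % N))

  suc-% : ∀ p → suc p % N ≡ suc (p % N) % N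
  suc-% p = subst₂ (λ a b → a % N ≡ b % N) (ℕ.+-comm p 1) (ℕ.+-comm (p % N) 1)
    (%-congˡ-+ p (p % N) 1 N (sym (m%n%n≡m%n p N)))

  -- the walk closes up: its last pair (k , 0) is followed by its first letter 0
  letter-suc : ∀ p → letter (suc p) ≡ proj₂ (pairAt (p % N))
  letter-suc p with ℕ.m≤n⇒m<n∨m≡n (m%n<n p N)
  ... | inj₁ 1+q<N = trans (cong (proj₁ ∘ pairAt) (trans (suc-% p) (m<n⇒m%n≡m 1+q<N))) (proj₁-next (pairAt (p % N)))
  ... | inj₂ 1+q≡N = trans (cong (proj₁ ∘ pairAt) (trans (suc-% p) (trans (cong (_% N) 1+q≡N) (n%n≡0 N))))
                           (sym (cong proj₂ (trans (cong pairAt q≡last) pairAt-last)))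
    where
    q≡last : p % N ≡ k * k + (k + k)
    q≡last = ℕ.suc-injective (trans 1+q≡N (square-suc k))

  letter-window : ∀ p → (letter p , letter (suc p)) ≡ pairAt (p % N)
  letter-window p = cong (letter p ,_) (letter-suc p)

  cycle : ℕ → Fin n
  cycle p = fromℕ< (proj₁ (pairAt-< (m%n<n p N)))

  window : ℕ → Fin n × Fin n
  window p = (cycle p , cycle (suc p))

  window-injective : ∀ {p q} → window p ≡ window q → p % N ≡ q % N
  window-injective {p} {q} eq = pairAt-injective (begin
    pairAt (p % N)                     ≡⟨ letter-window p ⟨
    (letter p , letter (suc p))        ≡⟨ toℕ-window p ⟨
    Product.map toℕ toℕ (window p)     ≡⟨ cong (Product.map toℕ toℕ) eq ⟩
    Product.map toℕ toℕ (window q)     ≡⟨ toℕ-window q ⟩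
    (letter q , letter (suc q))        ≡⟨ letter-window q ⟩
    pairAt (q % N)                     ∎)
    where
    open ≡-Reasoning
    toℕ-window : ∀ p → Product.map toℕ toℕ (window p) ≡ (letter p , letter (suc p))
    toℕ-window p = cong₂ _,_ (Fin.toℕ-fromℕ< _) (Fin.toℕ-fromℕ< _)

triangle : ℕ → ℕ
triangle zero    = 0
triangle (suc j) = triangle j + j

module ShiftedRows (k : ℕ) where
  open PairCycle k

  -- row y is the cycle shifted by triangle y, so rows y and y + 1 differ by a shift of y;
  -- only cells with nonnegative coordinates matter, ∣_∣ just reads them as naturals
  coloring : Coloring n
  coloring (x , y) = cycle (ℤ.∣ x ∣ + triangle ℤ.∣ y ∣)

  lowerPair upperPair : TetColoring n → Fin n × Fin n
  lowerPair (a , b , _ , _) = (a , b)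
  upperPair (_ , _ , c , d) = (c , d)

  lowerPair-instColoring : ∀ i j → lowerPair (instColoring coloring (+ i , + j)) ≡ window (i + triangle j)
  lowerPair-instColoring i j rewrite ℕ.+-identityʳ i | ℕ.+-identityʳ j | ℕ.+-comm i 1 = refl

  upperPair-instColoring : ∀ i j → upperPair (instColoring coloring (+ i , + j)) ≡ window (i + triangle j + j)
  upperPair-instColoring i j rewrite ℕ.+-identityʳ i | ℕ.+-comm i 1 | ℕ.+-comm j 1 | ℕ.+-assoc i (triangle j) j = refl

  %N-injective : ∀ {a b} → a < N → b < N → a % N ≡ b % N → a ≡ b
  %N-injective a<N b<N eq = trans (sym (m<n⇒m%n≡m a<N)) (trans eq (m<n⇒m%n≡m b<N))

  instColoring-injective : ∀ {i j i' j'} → i < N → j < N → i' < N → j' < N →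
    instColoring coloring (+ i , + j) ≡ instColoring coloring (+ i' , + j') → i ≡ i' × j ≡ j'
  instColoring-injective {i} {j} {i'} {j'} i<N j<N i'<N j'<N eq = i≡i' , j≡j'
    where
    lower : (i + triangle j) % N ≡ (i' + triangle j') % N
    lower = window-injective (trans (sym (lowerPair-instColoring i j)) (trans (cong lowerPair eq) (lowerPair-instColoring i' j')))
    upper : (i + triangle j + j) % N ≡ (i' + triangle j' + j') % N
    upper = window-injective (trans (sym (upperPair-instColoring i j)) (trans (cong upperPair eq) (upperPair-instColoring i' j')))
    j≡j' : j ≡ j'
    j≡j' = %N-injective j<N j'<N (%-cancelˡ-+ (i + triangle j) j j' N
      (trans upper (sym (%-congˡ-+ (i + triangle j) (i' + triangle j') j' N lower))))
    i≡i' : i ≡ i'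
    i≡i' = %N-injective i<N i'<N (%-cancelʳ-+ (triangle j) i i' N
      (subst (λ j' → (i + triangle j) % N ≡ (i' + triangle j') % N) (sym j≡j') lower))

-- Dilations of finite sets of integers

max-∈ : ∀ {x xs} → x ∈ xs → max x xs ∈ xs
max-∈ {x} {xs} x∈xs = [ (λ eq → subst (_∈ xs) (sym eq) x∈xs) , id ]′ (argmax-sel id x xs)

min-∈ : ∀ {x xs} → x ∈ xs → min x xs ∈ xs
min-∈ {x} {xs} x∈xs = [ (λ eq → subst (_∈ xs) (sym eq) x∈xs) , id ]′ (argmin-sel id x xs)

≤-max : ∀ x {y xs} → y ∈ xs → y ℤ.≤ max x xs
≤-max x {xs = xs} = All.lookup (xs≤max x xs)

min-≤ : ∀ x {y xs} → y ∈ xs → min x xs ℤ.≤ y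
min-≤ x {xs = xs} = All.lookup (min≤xs x xs)

suc-max-∉ : ∀ x xs → ℤ.suc (max x xs) ∉ xs
suc-max-∉ x xs s∈xs = ℤ.<-irrefl refl (ℤ.suc[i]≤j⇒i<j (≤-max x s∈xs))

offset : ∀ {a x} → a ℤ.≤ x → ∃ λ j → x ≡ + j ℤ.+ a
offset {a} {x} a≤x = ℤ.∣ x ℤ.- a ∣ , (begin
  x                     ≡⟨ cancel x a ⟨
  (x ℤ.- a) ℤ.+ a       ≡⟨ cong (ℤ._+ a) (ℤ.0≤i⇒+∣i∣≡i (ℤ.i≤j⇒0≤j-i a≤x)) ⟨
  + ℤ.∣ x ℤ.- a ∣ ℤ.+ a ∎)
  where
  open ≡-Reasoning
  cancel : ∀ x a → (x ℤ.- a) ℤ.+ a ≡ x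
  cancel = ℤSolver.solve-∀

dilate : List ℤ → List ℤ
dilate X = deduplicate ℤ._≟_ (X ++ map ℤ.suc X)

Unique-dilate : ∀ X → Unique (dilate X)
Unique-dilate X = deduplicate-! ℤ._≟_ (X ++ map ℤ.suc X)

∈-dilate⁺ˡ : ∀ {x X} → x ∈ X → x ∈ dilate X
∈-dilate⁺ˡ x∈X = ∈-deduplicate⁺ ℤ._≟_ (∈-++⁺ˡ x∈X)

∈-dilate⁺ʳ : ∀ {x X} → x ∈ X → ℤ.suc x ∈ dilate X
∈-dilate⁺ʳ {X = X} x∈X = ∈-deduplicate⁺ ℤ._≟_ (∈-++⁺ʳ X (∈-map⁺ ℤ.suc x∈X))

∈-dilate⁻ : ∀ {y X} → y ∈ dilate X → y ∈ X ⊎ ∃ λ x → x ∈ X × y ≡ ℤ.suc x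
∈-dilate⁻ {X = X} y∈ with ∈-++⁻ X (∈-deduplicate⁻ ℤ._≟_ (X ++ map ℤ.suc X) y∈)
... | inj₁ y∈X    = inj₁ y∈X
... | inj₂ y∈sucX = inj₂ (∈-map⁻ ℤ.suc y∈sucX)

length-dilate-> : ∀ {x X} → Unique X → x ∈ X → length X < length (dilate X)
length-dilate-> {x} {X} uX x∈X = fresh-⊆⇒length< ℤ._≟_ uX (suc-max-∉ x X) λ
  { (here refl) → ∈-dilate⁺ʳ (max-∈ x∈X)
  ; (there y∈X) → ∈-dilate⁺ˡ y∈X }

-- If dilating X adds a single element, X is closed under successor below its maximum, hence an interval.
module _ {X : List ℤ} (uX : Unique X) {z} (z∈X : z ∈ X) (thin : length (dilate X) ≤ suc (length X)) where

  private
    a b : ℤ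
    a = min z X
    b = max z X

    dilate⊆ : dilate X ⊆ ℤ.suc b ∷ X
    dilate⊆ = Unique-⊆-length≥⇒⊇ ℤ._≟_ (Unique-∷ (suc-max-∉ z X) uX) (λ
      { (here refl) → ∈-dilate⁺ʳ (max-∈ z∈X)
      ; (there x∈X) → ∈-dilate⁺ˡ x∈X }) thin

    suc-closed : ∀ {x} → x ∈ X → x ≢ b → ℤ.suc x ∈ X
    suc-closed {x} x∈X x≢b with dilate⊆ (∈-dilate⁺ʳ x∈X)
    ... | here eq   = ⊥-elim (x≢b (trans (sym (ℤ.pred-suc x)) (trans (cong ℤ.pred eq) (ℤ.pred-suc b))))
    ... | there s∈X = s∈X

    D : ℕ
    D = proj₁ (offset (min-≤ z (max-∈ z∈X)))

    b≡D+a : b ≡ + D ℤ.+ a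
    b≡D+a = proj₂ (offset (min-≤ z (max-∈ z∈X)))

    from-a : ∀ j → j ≤ D → + j ℤ.+ a ∈ X
    from-a zero    _   = subst (_∈ X) (sym (ℤ.+-identityˡ a)) (min-∈ z∈X)
    from-a (suc j) j<D = subst (_∈ X) (sym (ℤ.suc-+ j a))
      (suc-closed (from-a j (ℕ.<⇒≤ j<D)) (λ eq → ℤ.<⇒≢ (ℤ.+-monoˡ-< a (+<+ j<D)) (trans eq b≡D+a)))

    X⊆range : X ⊆ map (λ j → + j ℤ.+ a) (upTo (suc D))
    X⊆range x∈X with offset (min-≤ z x∈X)
    ... | j , refl = ∈-map⁺ (λ j → + j ℤ.+ a) (∈-upTo⁺ (s≤s j≤D))
      where
      j≤D : j ≤ D
      j≤D = ℕ.≮⇒≥ λ D<j → ℤ.<⇒≱ (ℤ.+-monoˡ-< a (+<+ D<j)) (subst (+ j ℤ.+ a ℤ.≤_) b≡D+a (≤-max z x∈X))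

    length-X≤ : length X ≤ suc D
    length-X≤ = subst (length X ≤_) (trans (length-map _ (upTo (suc D))) (length-upTo (suc D)))
      (Unique-⊆⇒length≤ ℤ._≟_ uX X⊆range)

  dilate-interval : ∃ λ a → ∀ i → i ≤ length X → + i ℤ.+ a ∈ dilate X
  dilate-interval = a , λ i i≤|X| →
    [ (λ i<1+D → ∈-dilate⁺ˡ (from-a i (s≤s⁻¹ i<1+D)))
    , (λ { refl → subst (_∈ dilate X) (trans (cong ℤ.suc b≡D+a) (sym (ℤ.suc-+ D a))) (∈-dilate⁺ʳ (max-∈ z∈X)) })
    ]′ (ℕ.m≤n⇒m<n∨m≡n (ℕ.≤-trans i≤|X| length-X≤))

_≟C_ : DecidableEquality Cell
_≟C_ = ≡-dec ℤ._≟_ ℤ._≟_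

range : ℕ → List ℤ
range k = map +_ (upTo k)

squareCells : ℕ → List Cell
squareCells k = cartesianProduct (range k) (range k)

Unique-squareCells : ∀ k → Unique (squareCells k)
Unique-squareCells k = cartesianProduct⁺ (map⁺ ℤ.+-injective (upTo⁺ k)) (map⁺ ℤ.+-injective (upTo⁺ k))

length-squareCells : ∀ k → length (squareCells k) ≡ k * k
length-squareCells k = trans (length-cartesianProduct (range k) (range k))
  (cong (λ l → l * l) (trans (length-map +_ (upTo k)) (length-upTo k)))

∈-squareCells⁺ : ∀ {k i j} → i < k → j < k → (+ i , + j) ∈ squareCells k
∈-squareCells⁺ i<k j<k = ∈-cartesianProduct⁺ (∈-map⁺ +_ (∈-upTo⁺ i<k)) (∈-map⁺ +_ (∈-upTo⁺ j<k))

∈-squareCells⁻ : ∀ {k u} → u ∈ squareCells k → ∃ λ i → ∃ λ j → i < k × j < k × u ≡ (+ i , + j)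
∈-squareCells⁻ {k} u∈ with ∈-cartesianProduct⁻ (range k) (range k) u∈
... | x∈ , y∈ with ∈-map⁻ +_ x∈ | ∈-map⁻ +_ y∈
... | i , i∈ , refl | j , j∈ , refl = i , j , ∈-upTo⁻ i∈ , ∈-upTo⁻ j∈ , refl

∈-squareCells⇒InSquare : ∀ {k u} → u ∈ squareCells k → InSquare k u
∈-squareCells⇒InSquare {k} u∈ with ∈-squareCells⁻ {k} u∈
... | i , j , i<k , j<k , refl = +≤+ z≤n , +<+ i<k , +≤+ z≤n , +<+ j<k

InSquare⇒∈-squareCells : ∀ {k u} → InSquare k u → u ∈ squareCells k
InSquare⇒∈-squareCells (+≤+ _ , +<+ i<k , +≤+ _ , +<+ j<k) = ∈-squareCells⁺ i<k j<k

⊕-cancelʳ : ∀ t {u v} → u ⊕ t ≡ v ⊕ t → u ≡ v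
⊕-cancelʳ (a , b) {x , y} {x' , y'} eq = cong₂ _,_ (∙-cancelʳ a x x' (cong proj₁ eq)) (∙-cancelʳ b y y' (cong proj₂ eq))

squareShape-of-⊆ : ∀ {S} k t → map (_⊕ t) (squareCells k) ⊆ S → length S ≤ k * k →
                   ∀ u → (u ⊕ t) ∈ S ⇔ InSquare k u
squareShape-of-⊆ {S} k t square⊆S |S|≤k*k u = mk⇔ to from
  where
  square = map (_⊕ t) (squareCells k)
  S⊆square : S ⊆ square
  S⊆square = Unique-⊆-length≥⇒⊇ _≟C_ (map⁺ (⊕-cancelʳ t) (Unique-squareCells k)) square⊆S
    (subst (length S ≤_) (sym (trans (length-map _ (squareCells k)) (length-squareCells k))) |S|≤k*k)
  to : (u ⊕ t) ∈ S → InSquare k u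
  to u⊕t∈S with ∈-map⁻ (_⊕ t) (S⊆square u⊕t∈S)
  ... | w , w∈ , eq = subst (InSquare k) (sym (⊕-cancelʳ t eq)) (∈-squareCells⇒InSquare w∈)
  from : InSquare k u → (u ⊕ t) ∈ S
  from sq = square⊆S (∈-map⁺ (_⊕ t) (InSquare⇒∈-squareCells sq))

module Lines (along across : Cell → ℤ) (step : Cell → Cell)
  (along-step : ∀ v → along (step v) ≡ ℤ.suc (along v))
  (across-step : ∀ v → across (step v) ≡ across v) where

  lines : List Cell → List ℤ
  lines A = deduplicate ℤ._≟_ (map across A)

  Unique-lines : ∀ A → Unique (lines A)
  Unique-lines A = deduplicate-! ℤ._≟_ (map across A)

  ∈-lines⁺ : ∀ {v A} → v ∈ A → across v ∈ lines A
  ∈-lines⁺ v∈A = ∈-deduplicate⁺ ℤ._≟_ (∈-map⁺ across v∈A)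

  ∈-lines⁻ : ∀ {k A} → k ∈ lines A → ∃ λ v → v ∈ A × k ≡ across v
  ∈-lines⁻ {A = A} k∈ = ∈-map⁻ across (∈-deduplicate⁻ ℤ._≟_ (map across A) k∈)

  module _ (A : List Cell) where

    lineThrough : Cell → List Cell
    lineThrough v = filter (λ w → across w ℤ.≟ across v) A

    lastOnLine : Cell → Cell
    lastOnLine v = argmax along v (lineThrough v)

    lastOnLine-∈ : ∀ {v} → v ∈ A → lastOnLine v ∈ A
    lastOnLine-∈ {v} v∈A = argmax-all along {P = _∈ A} {xs = lineThrough v} v∈A
      (All.tabulate (proj₁ ∘ ∈-filter⁻ (λ w → across w ℤ.≟ across v) {xs = A}))

    across-lastOnLine : ∀ v → across (lastOnLine v) ≡ across v
    across-lastOnLine v = argmax-all along {P = λ w → across w ≡ across v} {xs = lineThrough v} refl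
      (All.tabulate (proj₂ ∘ ∈-filter⁻ (λ w → across w ℤ.≟ across v) {xs = A}))

    step-lastOnLine-∉ : ∀ v → step (lastOnLine v) ∉ A
    step-lastOnLine-∉ v s∈A =
      ℤ.<-irrefl refl (ℤ.suc[i]≤j⇒i<j (subst (ℤ._≤ along (lastOnLine v)) (along-step _) s≤))
      where
      onLine : across (step (lastOnLine v)) ≡ across v
      onLine = trans (across-step _) (across-lastOnLine v)
      s≤ : along (step (lastOnLine v)) ℤ.≤ along (lastOnLine v)
      s≤ = All.lookup (f[xs]≤f[argmax] {f = along} v (lineThrough v))
             (∈-filter⁺ (λ w → across w ℤ.≟ across v) s∈A onLine)

  -- every line of A ends in a cell of A whose step leaves A
  length-lines-≤ : ∀ {A B} → Unique A → (∀ {v} → v ∈ A → v ∈ B × step v ∈ B) →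
                   length A + length (lines A) ≤ length B
  length-lines-≤ {A} {B} uA A⊆B = begin
    length A + length (lines A) ≤⟨ ℕ.+-monoʳ-≤ (length A) lines≤ends ⟩
    length A + length ends      ≡⟨ length-++ A ⟨
    length (A ++ ends)          ≤⟨ Unique-⊆⇒length≤ _≟C_ (++⁺ uA (deduplicate-! _≟C_ _) disjoint) A++ends⊆B ⟩
    length B                    ∎
    where
    open ℕ.≤-Reasoning
    ends : List Cell
    ends = deduplicate _≟C_ (map (step ∘ lastOnLine A) A)

    ∈-ends⁻ : ∀ {u} → u ∈ ends → ∃ λ v → v ∈ A × u ≡ step (lastOnLine A v)
    ∈-ends⁻ u∈ = ∈-map⁻ (step ∘ lastOnLine A) (∈-deduplicate⁻ _≟C_ _ u∈)

    disjoint : Disjoint A ends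
    disjoint (u∈A , u∈ends) with ∈-ends⁻ u∈ends
    ... | v , _ , refl = step-lastOnLine-∉ A v u∈A

    A++ends⊆B : A ++ ends ⊆ B
    A++ends⊆B u∈ with ∈-++⁻ A u∈
    ... | inj₁ u∈A = proj₁ (A⊆B u∈A)
    ... | inj₂ u∈ends with ∈-ends⁻ u∈ends
    ...   | v , v∈A , refl = proj₂ (A⊆B (lastOnLine-∈ A v∈A))

    lines⊆ : lines A ⊆ map across ends
    lines⊆ k∈ with ∈-lines⁻ k∈
    ... | v , v∈A , refl = subst (_∈ map across ends) (trans (across-step _) (across-lastOnLine A v))
                             (∈-map⁺ across (∈-deduplicate⁺ _≟C_ (∈-map⁺ (step ∘ lastOnLine A) v∈A)))

    lines≤ends : length (lines A) ≤ length ends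
    lines≤ends = subst (length (lines A) ≤_) (length-map across ends) (Unique-⊆⇒length≤ ℤ._≟_ (Unique-lines A) lines⊆)

right up : Cell → Cell
right v = (ℤ.suc (proj₁ v) , proj₂ v)
up    v = (proj₁ v , ℤ.suc (proj₂ v))

module Horizontal = Lines proj₁ proj₂ right (λ _ → refl) (λ _ → refl)
module Vertical   = Lines proj₂ proj₁ up    (λ _ → refl) (λ _ → refl)

rows cols : List Cell → List ℤ
rows = Horizontal.lines
cols = Vertical.lines

length-≤-cols*rows : ∀ {T} → Unique T → length T ≤ length (cols T) * length (rows T)
length-≤-cols*rows {T} uT = subst (length T ≤_) (length-cartesianProduct (cols T) (rows T))
  (Unique-⊆⇒length≤ _≟C_ uT (λ v∈T → ∈-cartesianProduct⁺ (Vertical.∈-lines⁺ v∈T) (Horizontal.∈-lines⁺ v∈T)))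

-- Corners of 2 × 2 blocks: the lower bound and the extremal shape

BlockIn : List Cell → Cell → Set
BlockIn S v = v ∈ S × right v ∈ S × up v ∈ S × right (up v) ∈ S

BlockCornersIn : List Cell → List Cell → Set
BlockCornersIn S T = ∀ {v} → v ∈ T → BlockIn S v

module _ {S T : List Cell} (uT : Unique T) (corners : BlockCornersIn S T) where

  private
    T∪rightT : List Cell
    T∪rightT = deduplicate _≟C_ (T ++ map right T)

    ∈-T∪rightT⁺ˡ : ∀ {v} → v ∈ T → v ∈ T∪rightT
    ∈-T∪rightT⁺ˡ v∈T = ∈-deduplicate⁺ _≟C_ (∈-++⁺ˡ v∈T)

    ∈-T∪rightT⁺ʳ : ∀ {v} → v ∈ T → right v ∈ T∪rightT
    ∈-T∪rightT⁺ʳ v∈T = ∈-deduplicate⁺ _≟C_ (∈-++⁺ʳ T (∈-map⁺ right v∈T))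

    T∪rightT-up : ∀ {v} → v ∈ T∪rightT → v ∈ S × up v ∈ S
    T∪rightT-up v∈ with ∈-++⁻ T (∈-deduplicate⁻ _≟C_ (T ++ map right T) v∈)
    ... | inj₁ v∈T = let (v∈S , _ , up∈S , _) = corners v∈T in v∈S , up∈S
    ... | inj₂ v∈rT with ∈-map⁻ right v∈rT
    ...   | w , w∈T , refl = let (_ , r∈S , _ , ru∈S) = corners w∈T in r∈S , ru∈S

    cols-grow : ∀ {z} → z ∈ T → suc (length (cols T)) ≤ length (cols T∪rightT)
    cols-grow {z} z∈T = fresh-⊆⇒length< ℤ._≟_ (Vertical.Unique-lines T) (suc-max-∉ (proj₁ z) (cols T)) λ
      { (here refl) → new
      ; (there x∈)  → old x∈ }
      where
      old : cols T ⊆ cols T∪rightT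
      old x∈ with Vertical.∈-lines⁻ x∈
      ... | v , v∈T , refl = Vertical.∈-lines⁺ (∈-T∪rightT⁺ˡ v∈T)
      new : ℤ.suc (max (proj₁ z) (cols T)) ∈ cols T∪rightT
      new with Vertical.∈-lines⁻ (max-∈ (Vertical.∈-lines⁺ z∈T))
      ... | v , v∈T , eq = subst (_∈ cols T∪rightT) (cong ℤ.suc (sym eq)) (Vertical.∈-lines⁺ (∈-T∪rightT⁺ʳ v∈T))

  corners-length-≤ : ∀ {z} → z ∈ T → suc (length T + (length (cols T) + length (rows T))) ≤ length S
  corners-length-≤ z∈T = begin
    suc (length T + (length (cols T) + length (rows T))) ≡⟨ rearrange (length T) (length (cols T)) (length (rows T)) ⟩
    length T + length (rows T) + suc (length (cols T))   ≤⟨ ℕ.+-mono-≤ rows≤ (cols-grow z∈T) ⟩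
    length T∪rightT + length (cols T∪rightT)             ≤⟨ Vertical.length-lines-≤ (deduplicate-! _≟C_ _) T∪rightT-up ⟩
    length S                                             ∎
    where
    open ℕ.≤-Reasoning
    rows≤ = Horizontal.length-lines-≤ uT (λ v∈T → ∈-T∪rightT⁺ˡ v∈T , ∈-T∪rightT⁺ʳ v∈T)
    rearrange : ∀ t c r → suc (t + (c + r)) ≡ t + r + suc c
    rearrange = solve-∀

corners-lower-bound : ∀ {S T z m} → Unique T → BlockCornersIn S T → z ∈ T → length T ≡ m * m →
                      suc m * suc m ≤ length S
corners-lower-bound {S} {T} {z} {m} uT corners z∈T |T|≡m*m = begin
  suc m * suc m                                    ≡⟨ square-suc m ⟩
  suc (m * m + (m + m))                            ≤⟨ s≤s (ℕ.+-mono-≤ (ℕ.≤-reflexive (sym |T|≡m*m)) (am-gm m c r mm≤cr)) ⟩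
  suc (length T + (length (cols T) + length (rows T))) ≤⟨ corners-length-≤ uT corners z∈T ⟩
  length S                                         ∎
  where
  open ℕ.≤-Reasoning
  c = length (cols T)
  r = length (rows T)
  mm≤cr = subst (_≤ c * r) |T|≡m*m (length-≤-cols*rows uT)

module _ {S T : List Cell} (uT : Unique T) (corners : BlockCornersIn S T) {z} (z∈T : z ∈ T)
         {m} (|T|≡m*m : length T ≡ m * m) (|S|≤ : length S ≤ suc m * suc m) where

  private
    c r : ℕ
    c = length (cols T)
    r = length (rows T)

    c+r≤2m : c + r ≤ m + m
    c+r≤2m = ℕ.+-cancelˡ-≤ (m * m) _ _ (s≤s⁻¹ (begin
      suc (m * m + (c + r))      ≡⟨ cong (λ t → suc (t + (c + r))) |T|≡m*m ⟨
      suc (length T + (c + r))   ≤⟨ corners-length-≤ uT corners z∈T ⟩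
      length S                   ≤⟨ |S|≤ ⟩
      suc m * suc m              ≡⟨ square-suc m ⟩
      suc (m * m + (m + m))      ∎))
      where open ℕ.≤-Reasoning

    c≡m×r≡m : c ≡ m × r ≡ m
    c≡m×r≡m = am-gm-equality m c r c+r≤2m (subst (_≤ c * r) |T|≡m*m (length-≤-cols*rows uT))

    cols×rows⊆T : cartesianProduct (cols T) (rows T) ⊆ T
    cols×rows⊆T = Unique-⊆-length≥⇒⊇ _≟C_ uT
      (λ v∈T → ∈-cartesianProduct⁺ (Vertical.∈-lines⁺ v∈T) (Horizontal.∈-lines⁺ v∈T))
      (ℕ.≤-reflexive (begin
        length (cartesianProduct (cols T) (rows T)) ≡⟨ length-cartesianProduct (cols T) (rows T) ⟩
        c * r                                       ≡⟨ cong₂ _*_ (proj₁ c≡m×r≡m) (proj₂ c≡m×r≡m) ⟩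
        m * m                                       ≡⟨ |T|≡m*m ⟨
        length T                                    ∎))
      where open ≡-Reasoning

    block : ∀ {x y} → x ∈ cols T → y ∈ rows T → BlockIn S (x , y)
    block x∈C y∈R = corners (cols×rows⊆T (∈-cartesianProduct⁺ x∈C y∈R))

    dilated⊆S : cartesianProduct (dilate (cols T)) (dilate (rows T)) ⊆ S
    dilated⊆S u∈ with ∈-cartesianProduct⁻ (dilate (cols T)) (dilate (rows T)) u∈
    ... | x∈ , y∈ with ∈-dilate⁻ {X = cols T} x∈ | ∈-dilate⁻ {X = rows T} y∈
    ... | inj₁ x∈C              | inj₁ y∈R              = proj₁ (block x∈C y∈R)
    ... | inj₂ (x , x∈C , refl) | inj₁ y∈R              = proj₁ (proj₂ (block x∈C y∈R))
    ... | inj₁ x∈C              | inj₂ (y , y∈R , refl) = proj₁ (proj₂ (proj₂ (block x∈C y∈R)))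
    ... | inj₂ (x , x∈C , refl) | inj₂ (y , y∈R , refl) = proj₂ (proj₂ (proj₂ (block x∈C y∈R)))

    dilated-length-≤ : length (dilate (cols T)) * length (dilate (rows T)) ≤ suc m * suc m
    dilated-length-≤ = ℕ.≤-trans
      (subst (_≤ length S) (length-cartesianProduct (dilate (cols T)) (dilate (rows T)))
        (Unique-⊆⇒length≤ _≟C_ (cartesianProduct⁺ (Unique-dilate (cols T)) (Unique-dilate (rows T))) dilated⊆S))
      |S|≤

    m<dilate-cols : m < length (dilate (cols T))
    m<dilate-cols = subst (_< length (dilate (cols T))) (proj₁ c≡m×r≡m)
      (length-dilate-> (Vertical.Unique-lines T) (Vertical.∈-lines⁺ z∈T))

    m<dilate-rows : m < length (dilate (rows T))
    m<dilate-rows = subst (_< length (dilate (rows T))) (proj₂ c≡m×r≡m)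
      (length-dilate-> (Horizontal.Unique-lines T) (Horizontal.∈-lines⁺ z∈T))

    thin-cols : length (dilate (cols T)) ≤ suc c
    thin-cols = subst (λ l → length (dilate (cols T)) ≤ suc l) (sym (proj₁ c≡m×r≡m))
      (ℕ.*-cancelʳ-≤ _ _ (suc m) (ℕ.≤-trans (ℕ.*-monoʳ-≤ (length (dilate (cols T))) m<dilate-rows) dilated-length-≤))

    thin-rows : length (dilate (rows T)) ≤ suc r
    thin-rows = subst (λ l → length (dilate (rows T)) ≤ suc l) (sym (proj₂ c≡m×r≡m))
      (ℕ.*-cancelˡ-≤ (suc m) (ℕ.≤-trans (ℕ.*-monoˡ-≤ (length (dilate (rows T))) m<dilate-cols) dilated-length-≤))

  corners-squareShape : ∃ λ t → ∀ u → (u ⊕ t) ∈ S ⇔ InSquare (suc m) u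
  corners-squareShape = (a , b) , squareShape-of-⊆ (suc m) (a , b) square⊆S |S|≤
    where
    colsInterval = dilate-interval (Vertical.Unique-lines T) (Vertical.∈-lines⁺ z∈T) thin-cols
    rowsInterval = dilate-interval (Horizontal.Unique-lines T) (Horizontal.∈-lines⁺ z∈T) thin-rows
    a b : ℤ
    a = proj₁ colsInterval
    b = proj₁ rowsInterval
    square⊆S : map (_⊕ (a , b)) (squareCells (suc m)) ⊆ S
    square⊆S w∈ with ∈-map⁻ (_⊕ (a , b)) w∈
    ... | u , u∈ , refl with ∈-squareCells⁻ {suc m} u∈
    ... | i , j , i<1+m , j<1+m , refl = dilated⊆S (∈-cartesianProduct⁺
      (proj₂ colsInterval i (subst (i ≤_) (sym (proj₁ c≡m×r≡m)) (s≤s⁻¹ i<1+m)))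
      (proj₂ rowsInterval j (subst (j ≤_) (sym (proj₂ c≡m×r≡m)) (s≤s⁻¹ j<1+m))))

PathIn-++ : ∀ {S u w v} → PathIn S u w → PathIn S w v → PathIn S u v
PathIn-++ (here _)        q = q
PathIn-++ (step u∈ adj p) q = step u∈ adj (PathIn-++ p q)

PathIn-source : ∀ {S u v} → PathIn S u v → u ∈ S
PathIn-source (here u∈)     = u∈
PathIn-source (step u∈ _ _) = u∈

Adjacent-sym : ∀ {u v} → Adjacent u v → Adjacent v u
Adjacent-sym {a , b} {c , d} = subst (_≡ 1) (cong₂ _+_ (∣-∣-comm a c) (∣-∣-comm b d))
  where
  ∣-∣-comm : ∀ a c → ℤ.∣ a ℤ.- c ∣ ≡ ℤ.∣ c ℤ.- a ∣
  ∣-∣-comm a c = trans (cong ℤ.∣_∣ (negate a c)) (ℤ.∣-i∣≡∣i∣ (c ℤ.- a))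
    where
    negate : ∀ a c → a ℤ.- c ≡ ℤ.- (c ℤ.- a)
    negate = ℤSolver.solve-∀

PathIn-reverse : ∀ {S u v} → PathIn S u v → PathIn S v u
PathIn-reverse (here u∈)               = here u∈
PathIn-reverse (step {u} {w} u∈ adj p) =
  PathIn-++ (PathIn-reverse p) (step (PathIn-source p) (Adjacent-sym {u} {w} adj) (here u∈))

Adjacent-right : ∀ v → Adjacent (right v) v
Adjacent-right (x , y) = cong₂ _+_ (cong ℤ.∣_∣ (suc-minus x)) (cong ℤ.∣_∣ (ℤ.+-inverseʳ y))
  where
  suc-minus : ∀ x → 1ℤ ℤ.+ x ℤ.- x ≡ 1ℤ
  suc-minus = ℤSolver.solve-∀

Adjacent-up : ∀ v → Adjacent (up v) v
Adjacent-up (x , y) = subst (_≡ 1) (ℕ.+-comm ℤ.∣ ℤ.suc y ℤ.- y ∣ ℤ.∣ x ℤ.- x ∣) (Adjacent-right (y , x))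

squareCells-connected : ∀ k → EdgeConnected (squareCells k)
squareCells-connected k u∈ v∈ = PathIn-++ (toOrigin u∈) (PathIn-reverse (toOrigin v∈))
  where
  toColumn0 : ∀ {i j} → i < k → j < k → PathIn (squareCells k) (+ i , + j) (+ 0 , + j)
  toColumn0 {zero}      0<k j<k = here (∈-squareCells⁺ 0<k j<k)
  toColumn0 {suc i} {j} i<k j<k =
    step (∈-squareCells⁺ i<k j<k) (Adjacent-right (+ i , + j)) (toColumn0 (ℕ.<⇒≤ i<k) j<k)
  toOrigin0 : ∀ {j} → 0 < k → j < k → PathIn (squareCells k) (+ 0 , + j) (+ 0 , + 0)
  toOrigin0 {zero}  0<k _   = here (∈-squareCells⁺ 0<k 0<k)
  toOrigin0 {suc j} 0<k j<k =
    step (∈-squareCells⁺ 0<k j<k) (Adjacent-up (+ 0 , + j)) (toOrigin0 0<k (ℕ.<⇒≤ j<k))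
  toOrigin : ∀ {u} → u ∈ squareCells k → PathIn (squareCells k) u (+ 0 , + 0)
  toOrigin u∈ with ∈-squareCells⁻ {k} u∈
  ... | i , j , i<k , j<k , refl = PathIn-++ (toColumn0 i<k j<k) (toOrigin0 (ℕ.≤-<-trans z≤n i<k) j<k)

square : ℕ → Polyomino
square k = record
  { cells     = squareCells (suc k)
  ; unique    = Unique-squareCells (suc k)
  ; nonempty  = λ ()
  ; connected = squareCells-connected (suc k)
  }

⊕-block : ∀ v → v ⊕ (+ 0 , + 0) ≡ v × v ⊕ (+ 1 , + 0) ≡ right v × v ⊕ (+ 0 , + 1) ≡ up v × v ⊕ (+ 1 , + 1) ≡ right (up v)
⊕-block (x , y) = cong₂ _,_ x+0 y+0 , cong₂ _,_ x+1 y+0 , cong₂ _,_ x+0 y+1 , cong₂ _,_ x+1 y+1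
  where
  x+0 = ℤ.+-identityʳ x
  y+0 = ℤ.+-identityʳ y
  x+1 = ℤ.+-comm x 1ℤ
  y+1 = ℤ.+-comm y 1ℤ

InstanceIn⇒BlockIn : ∀ {P v} → InstanceIn P v → BlockIn (cells P) v
InstanceIn⇒BlockIn {P} {v} (c₀₀ , c₁₀ , c₀₁ , c₁₁) =
  let (e₀₀ , e₁₀ , e₀₁ , e₁₁) = ⊕-block v
  in subst (_∈ cells P) e₀₀ c₀₀ , subst (_∈ cells P) e₁₀ c₁₀ , subst (_∈ cells P) e₀₁ c₀₁ , subst (_∈ cells P) e₁₁ c₁₁

BlockIn⇒InstanceIn : ∀ {P v} → BlockIn (cells P) v → InstanceIn P v
BlockIn⇒InstanceIn {P} {v} (c₀₀ , c₁₀ , c₀₁ , c₁₁) =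
  let (e₀₀ , e₁₀ , e₀₁ , e₁₁) = ⊕-block v
  in subst (_∈ cells P) (sym e₀₀) c₀₀ , subst (_∈ cells P) (sym e₁₀) c₁₀ ,
     subst (_∈ cells P) (sym e₀₁) c₀₁ , subst (_∈ cells P) (sym e₁₁) c₁₁

tetColorings : ∀ n → List (TetColoring n)
tetColorings n = cartesianProduct (allFin n) (cartesianProduct (allFin n) (cartesianProduct (allFin n) (allFin n)))

∈-tetColorings : ∀ {n} (π : TetColoring n) → π ∈ tetColorings n
∈-tetColorings (a , b , c , d) =
  ∈-cartesianProduct⁺ (∈-allFin a) (∈-cartesianProduct⁺ (∈-allFin b) (∈-cartesianProduct⁺ (∈-allFin c) (∈-allFin d)))

Unique-tetColorings : ∀ n → Unique (tetColorings n)
Unique-tetColorings n =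
  cartesianProduct⁺ (allFin⁺ n) (cartesianProduct⁺ (allFin⁺ n) (cartesianProduct⁺ (allFin⁺ n) (allFin⁺ n)))

length-tetColorings : ∀ n → length (tetColorings n) ≡ (n * n) * (n * n)
length-tetColorings n = begin
  length (tetColorings n)
    ≡⟨ length-cartesianProduct (allFin n) _ ⟩
  length (allFin n) * length (cartesianProduct (allFin n) (cartesianProduct (allFin n) (allFin n)))
    ≡⟨ cong (length (allFin n) *_) (length-cartesianProduct (allFin n) _) ⟩
  length (allFin n) * (length (allFin n) * length (cartesianProduct (allFin n) (allFin n)))
    ≡⟨ cong (λ l → length (allFin n) * (length (allFin n) * l)) (length-cartesianProduct (allFin n) (allFin n)) ⟩
  length (allFin n) * (length (allFin n) * (length (allFin n) * length (allFin n)))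
    ≡⟨ cong (λ l → l * (l * (l * l))) (length-tabulate {n = n} id) ⟩
  n * (n * (n * n))
    ≡⟨ reassociate n ⟩
  (n * n) * (n * n) ∎
  where
  open ≡-Reasoning
  reassociate : ∀ n → n * (n * (n * n)) ≡ (n * n) * (n * n)
  reassociate = solve-∀

module DeBruijnCorners {n Q} {d : Coloring n} (db : IsDeBruijn n Q d) where

  corner : TetColoring n → Cell
  corner π = proj₁ (db π)

  corners : List Cell
  corners = map corner (tetColorings n)

  Unique-corners : Unique corners
  Unique-corners = map⁺ corner-injective (Unique-tetColorings n)
    where
    colors : ∀ π → instColoring d (corner π) ≡ π
    colors π = proj₂ (proj₁ (proj₂ (db π)))
    corner-injective : ∀ {π π'} → corner π ≡ corner π' → π ≡ π'
    corner-injective {π} {π'} eq = trans (sym (colors π)) (trans (cong (instColoring d) eq) (colors π'))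

  corners-blocks : BlockCornersIn (cells Q) corners
  corners-blocks v∈ with ∈-map⁻ corner v∈
  ... | π , _ , refl = InstanceIn⇒BlockIn {Q} (proj₁ (proj₁ (proj₂ (db π))))

  length-corners : length corners ≡ (n * n) * (n * n)
  length-corners = trans (length-map corner (tetColorings n)) (length-tetColorings n)

  ∈-corners : ∀ π → corner π ∈ corners
  ∈-corners π = ∈-map⁺ corner (∈-tetColorings π)

module ColoredSquare (k : ℕ) where
  open PairCycle k
  open ShiftedRows k

  cornerCell : Fin N × Fin N → Cell
  cornerCell (i , j) = (+ toℕ i , + toℕ j)

  cornerCell-instance : ∀ ij → InstanceIn (square N) (cornerCell ij)
  cornerCell-instance (i , j) = BlockIn⇒InstanceIn {square N}
    (∈-squareCells⁺ i≤N j≤N , ∈-squareCells⁺ i<N′ j≤N , ∈-squareCells⁺ i≤N j<N′ , ∈-squareCells⁺ i<N′ j<N′)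
    where
    i<N′ = s≤s (Fin.toℕ<n i)
    j<N′ = s≤s (Fin.toℕ<n j)
    i≤N  = ℕ.m<n⇒m<1+n (Fin.toℕ<n i)
    j≤N  = ℕ.m<n⇒m<1+n (Fin.toℕ<n j)

  instance-corner : ∀ {w} → InstanceIn (square N) w → ∃ λ i → ∃ λ j → i < N × j < N × w ≡ (+ i , + j)
  instance-corner {w} inst with InstanceIn⇒BlockIn {square N} {w} inst
  ... | w∈ , _ , _ , ru∈ with ∈-squareCells⁻ {suc N} w∈
  ... | i , j , _ , _ , refl with ∈-squareCells⁻ {suc N} ru∈
  ... | _ , _ , 1+i<1+N , 1+j<1+N , refl = i , j , s≤s⁻¹ 1+i<1+N , s≤s⁻¹ 1+j<1+N , refl

  cornerColoring : Fin N × Fin N → TetColoring n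
  cornerColoring ij = instColoring coloring (cornerCell ij)

  cornerColoring-injective : ∀ {ij ij'} → cornerColoring ij ≡ cornerColoring ij' → ij ≡ ij'
  cornerColoring-injective {i , j} {i' , j'} eq =
    let (i≡i' , j≡j') = instColoring-injective (Fin.toℕ<n i) (Fin.toℕ<n j) (Fin.toℕ<n i') (Fin.toℕ<n j') eq
    in cong₂ _,_ (Fin.toℕ-injective i≡i') (Fin.toℕ-injective j≡j')

  cornerColoring-onto : ∀ π → ∃ λ ij → cornerColoring ij ≡ π
  cornerColoring-onto π with ∈-map⁻ cornerColoring {xs = cornerPairs} (tetColorings⊆ (∈-tetColorings π))
    where
    cornerPairs = cartesianProduct (allFin N) (allFin N)
    tetColorings⊆ : tetColorings n ⊆ map cornerColoring cornerPairs
    tetColorings⊆ = Unique-⊆-length≥⇒⊇ (≡-dec Fin._≟_ (≡-dec Fin._≟_ (≡-dec Fin._≟_ Fin._≟_)))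
      (map⁺ cornerColoring-injective (cartesianProduct⁺ (allFin⁺ N) (allFin⁺ N))) (λ _ → ∈-tetColorings _)
      (ℕ.≤-reflexive (begin
        length (tetColorings n)                 ≡⟨ length-tetColorings n ⟩
        N * N                                   ≡⟨ cong (λ l → l * l) (length-tabulate {n = N} id) ⟨
        length (allFin N) * length (allFin N)   ≡⟨ length-cartesianProduct (allFin N) (allFin N) ⟨
        length cornerPairs                      ≡⟨ length-map cornerColoring cornerPairs ⟨
        length (map cornerColoring cornerPairs) ∎))
      where open ≡-Reasoning
  ... | ij , _ , π≡ = ij , sym π≡

  cornerCell-unique : ∀ {w} ij → InstanceIn (square N) w → instColoring coloring w ≡ cornerColoring ij → w ≡ cornerCell ij
  cornerCell-unique {w} (i , j) inst eq with instance-corner {w} inst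
  ... | i' , j' , i'<N , j'<N , refl =
    let (i'≡i , j'≡j) = instColoring-injective i'<N j'<N (Fin.toℕ<n i) (Fin.toℕ<n j) eq
    in cong₂ (λ a b → (+ a , + b)) i'≡i j'≡j

  square-isDeBruijn : IsDeBruijn n (square N) coloring
  square-isDeBruijn π =
    let (ij , colors) = cornerColoring-onto π
    in cornerCell ij , (cornerCell-instance ij , colors) ,
       λ w inst eq → cornerCell-unique ij inst (trans eq (sym colors))

  square-isPrismatic : IsPrismatic n (square N) coloring
  square-isPrismatic = square-isDeBruijn , λ Q d db → let open DeBruijnCorners {Q = Q} {d = d} db in
    subst (_≤ size Q) (sym (length-squareCells (suc N)))
      (corners-lower-bound Unique-corners corners-blocks (∈-corners (Fin.zero , Fin.zero , Fin.zero , Fin.zero)) length-corners)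

  prismatic-squareShape : ∀ P c → IsPrismatic n P c → HasSquareShape (suc N) P
  prismatic-squareShape P c (db , minimal) = let open DeBruijnCorners {Q = P} {d = c} db in
    corners-squareShape Unique-corners corners-blocks (∈-corners (Fin.zero , Fin.zero , Fin.zero , Fin.zero)) length-corners
      (subst (size P ≤_) (length-squareCells (suc N)) (minimal (square N) coloring square-isDeBruijn))

theorem4p4 : (n : ℕ) → 1 ≤ n →
    (∃[ P ] ∃[ c ] IsPrismatic n P c) ×
    (∀ (P : Polyomino) (c : Coloring n) → IsPrismatic n P c →
    HasSquareShape (n ^ 2 + 1) P)
theorem4p4 (suc k) _ = (square N , coloring , square-isPrismatic) ,
  λ P c prismatic → subst (λ s → HasSquareShape s P) (1+N≡n^2+1 k) (prismatic-squareShape P c prismatic)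
  where
  open ColoredSquare k
  open PairCycle k using (N)
  open ShiftedRows k using (coloring)
  -- n ^ 2 unfolds to n * (n * 1)
  1+N≡n^2+1 : ∀ k → suc (suc k * suc k) ≡ suc k * (suc k * 1) + 1
  1+N≡n^2+1 = solve-∀
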